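{- Let $\mathbf L=(L,\lor,\land,*,1)$ be a lattice skew Hilbert algebra and $F$ a filter of $\mathbf L$. Then $\Phi(F)$ is a congruence of $\mathbf L$ and $[1](\Phi(F))=F$.
   Context: A lattice skew Hilbert algebra is an algebra $(L,\lor,\land,*,1)$ where $(L,\lor,\land)$ is a lattice and the identities $x*(x\lor y)\approx1$, $x*((x*y)*y)\approx1$, $((x\lor y)*z)*(x*z)\approx1$, $(x\lor y)\land(x*y)\approx y$ hold. A filter of $\mathbf L$ is a subset $F\subseteq L$ containing $1$ such that for all $x,y,z,v\in L$, if $x*y,y*x,z*v,v*z\in F$ then $(x\lor z)*(y\lor v)$, $(x\land z)*(y\land v)$, $(x*z)*(y*v)\in F$. For $M\subseteq L$, $\Phi(M):=\{(x,y)\in L^2\mid x*y,y*x\in M\}$. Congruences are those of the algebra $(L,\lor,\land,*,1)$. -}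

module Defs where

open import Level using (Level; suc; _⊔_)
open import Relation.Binary.PropositionalEquality using (_≡_)
open import Relation.Binary.Structures using (IsEquivalence)
open import Data.Product using (_×_)

record IsLatticeOps {a} (L : Set a) (_∨_ _∧_ : L → L → L) : Set a where
  field
    ∨-comm   : ∀ x y → (x ∨ y) ≡ (y ∨ x)
    ∨-assoc  : ∀ x y z → ((x ∨ y) ∨ z) ≡ (x ∨ (y ∨ z))
    ∧-comm   : ∀ x y → (x ∧ y) ≡ (y ∧ x)
    ∧-assoc  : ∀ x y z → ((x ∧ y) ∧ z) ≡ (x ∧ (y ∧ z))
    ∨-absorbs-∧ : ∀ x y → (x ∨ (x ∧ y)) ≡ x
    ∧-absorbs-∨ : ∀ x y → (x ∧ (x ∨ y)) ≡ x

record LatticeSkewHilbert (a : Level) : Set (suc a) where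
  infixr 6 _∨_
  infixr 7 _∧_
  infixr 5 _*_
  field
    Carrier : Set a
    _∨_ _∧_ _*_ : Carrier → Carrier → Carrier
    𝟏 : Carrier
    isLattice : IsLatticeOps Carrier _∨_ _∧_
    ax1 : ∀ x y → (x * (x ∨ y)) ≡ 𝟏
    ax2 : ∀ x y → (x * ((x * y) * y)) ≡ 𝟏
    ax3 : ∀ x y z → (((x ∨ y) * z) * (x * z)) ≡ 𝟏
    ax4 : ∀ x y → ((x ∨ y) ∧ (x * y)) ≡ y

module _ {a} (𝐋 : LatticeSkewHilbert a) where
  open LatticeSkewHilbert 𝐋

  Subset : Set (suc a)
  Subset = Carrier → Set a

  record IsFilter (F : Subset) : Set a where
    field
      contains-𝟏 : F 𝟏
      closed : ∀ x y z v → F (x * y) → F (y * x) → F (z * v) → F (v * z) →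
               F ((x ∨ z) * (y ∨ v)) × F ((x ∧ z) * (y ∧ v)) × F ((x * z) * (y * v))

  Φ : Subset → Carrier → Carrier → Set a
  Φ M x y = M (x * y) × M (y * x)

  record IsCongruence (θ : Carrier → Carrier → Set a) : Set a where
    field
      isEquivalence : IsEquivalence θ
      ∨-cong : ∀ {x y z v} → θ x y → θ z v → θ (x ∨ z) (y ∨ v)
      ∧-cong : ∀ {x y z v} → θ x y → θ z v → θ (x ∧ z) (y ∧ v)
      *-cong : ∀ {x y z v} → θ x y → θ z v → θ (x * z) (y * v)

  class1 : (Carrier → Carrier → Set a) → Subset
  class1 θ x = θ x 𝟏

  _≐_ : Subset → Subset → Set a
  A ≐ B = (∀ x → A x → B x) × (∀ x → B x → A x)

-- Compatibility of Φ(F) with ∨, ∧ and * is exactly the closure condition in the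
-- definition of a filter, and reflexivity comes from x * x = 1. The only real work is
-- transitivity, which reduces to modus ponens for F (p, p * q ∈ F ⇒ q ∈ F): from
-- Φ(p, 1) we get Φ(p ∨ q, 1), and meeting with Φ(p * q, 1) gives
-- Φ((p ∨ q) ∧ (p * q), 1), i.e. Φ(q, 1) by the fourth axiom. Finally x ∈ F iff
-- Φ(x, 1), because x * 1 = 1 and 1 * x = x.
module Submission where

open import Defs
open import Data.Product using (_×_; _,_; proj₁; proj₂)
open import Relation.Binary.PropositionalEquality
  using (_≡_; sym; trans; cong; cong₂; subst; subst₂; module ≡-Reasoning)

module SkewHilbertProperties {a} (𝐋 : LatticeSkewHilbert a) where
  open LatticeSkewHilbert 𝐋
  open IsLatticeOps isLattice
  open ≡-Reasoning

  ∨-idem : ∀ x → x ∨ x ≡ x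
  ∨-idem x = begin
    x ∨ x             ≡⟨ cong (x ∨_) (sym (∧-absorbs-∨ x x)) ⟩
    x ∨ x ∧ (x ∨ x)   ≡⟨ ∨-absorbs-∧ x (x ∨ x) ⟩
    x                 ∎

  *-diag : ∀ x → x * x ≡ 𝟏
  *-diag x = trans (cong (x *_) (sym (∨-idem x))) (ax1 x x)

  ∧-identityʳ : ∀ x → x ∧ 𝟏 ≡ x
  ∧-identityʳ x = trans (cong₂ _∧_ (sym (∨-idem x)) (sym (*-diag x))) (ax4 x x)

  ∨-zeroˡ : ∀ x → 𝟏 ∨ x ≡ 𝟏
  ∨-zeroˡ x = begin
    𝟏 ∨ x         ≡⟨ cong (𝟏 ∨_) (sym (∧-identityʳ x)) ⟩
    𝟏 ∨ x ∧ 𝟏     ≡⟨ cong (𝟏 ∨_) (∧-comm x 𝟏) ⟩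
    𝟏 ∨ 𝟏 ∧ x     ≡⟨ ∨-absorbs-∧ 𝟏 x ⟩
    𝟏             ∎

  *-zeroʳ : ∀ x → x * 𝟏 ≡ 𝟏
  *-zeroʳ x = trans (cong (x *_) (sym (trans (∨-comm x 𝟏) (∨-zeroˡ x)))) (ax1 x 𝟏)

  *-identityˡ : ∀ x → 𝟏 * x ≡ x
  *-identityˡ x = begin
    𝟏 * x                 ≡⟨ sym (∧-identityʳ (𝟏 * x)) ⟩
    (𝟏 * x) ∧ 𝟏           ≡⟨ ∧-comm (𝟏 * x) 𝟏 ⟩
    𝟏 ∧ (𝟏 * x)           ≡⟨ cong (_∧ (𝟏 * x)) (sym (∨-zeroˡ x)) ⟩
    (𝟏 ∨ x) ∧ (𝟏 * x)     ≡⟨ ax4 𝟏 x ⟩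
    x                     ∎

module FilterCongruence {a} (𝐋 : LatticeSkewHilbert a) (F : Subset 𝐋) (isFilter : IsFilter 𝐋 F) where
  open LatticeSkewHilbert 𝐋
  open IsFilter isFilter
  open SkewHilbertProperties 𝐋

  Φ-refl : ∀ x → Φ 𝐋 F x x
  Φ-refl x = let x*x∈F = subst F (sym (*-diag x)) contains-𝟏 in x*x∈F , x*x∈F

  Φ-sym : ∀ {x y} → Φ 𝐋 F x y → Φ 𝐋 F y x
  Φ-sym (xy , yx) = yx , xy

  Φ-∨ : ∀ {x y z v} → Φ 𝐋 F x y → Φ 𝐋 F z v → Φ 𝐋 F (x ∨ z) (y ∨ v)
  Φ-∨ {x} {y} {z} {v} (xy , yx) (zv , vz) =
    proj₁ (closed x y z v xy yx zv vz) , proj₁ (closed y x v z yx xy vz zv)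

  Φ-∧ : ∀ {x y z v} → Φ 𝐋 F x y → Φ 𝐋 F z v → Φ 𝐋 F (x ∧ z) (y ∧ v)
  Φ-∧ {x} {y} {z} {v} (xy , yx) (zv , vz) =
    proj₁ (proj₂ (closed x y z v xy yx zv vz)) , proj₁ (proj₂ (closed y x v z yx xy vz zv))

  Φ-* : ∀ {x y z v} → Φ 𝐋 F x y → Φ 𝐋 F z v → Φ 𝐋 F (x * z) (y * v)
  Φ-* {x} {y} {z} {v} (xy , yx) (zv , vz) =
    proj₂ (proj₂ (closed x y z v xy yx zv vz)) , proj₂ (proj₂ (closed y x v z yx xy vz zv))

  ∈⇒Φ-𝟏 : ∀ {x} → F x → Φ 𝐋 F x 𝟏
  ∈⇒Φ-𝟏 {x} x∈F = subst F (sym (*-zeroʳ x)) contains-𝟏 , subst F (sym (*-identityˡ x)) x∈F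

  Φ-𝟏⇒∈ : ∀ {x} → Φ 𝐋 F x 𝟏 → F x
  Φ-𝟏⇒∈ {x} (_ , 𝟏*x∈F) = subst F (*-identityˡ x) 𝟏*x∈F

  modus-ponens : ∀ {p q} → F p → F (p * q) → F q
  modus-ponens {p} {q} p∈F p*q∈F =
    Φ-𝟏⇒∈ (subst₂ (Φ 𝐋 F) (ax4 p q) (∧-identityʳ 𝟏) (Φ-∧ p∨q~𝟏 (∈⇒Φ-𝟏 p*q∈F)))
    where
    p∨q~𝟏 : Φ 𝐋 F (p ∨ q) 𝟏
    p∨q~𝟏 = subst (Φ 𝐋 F (p ∨ q)) (∨-zeroˡ q) (Φ-∨ (∈⇒Φ-𝟏 p∈F) (Φ-refl q))

  Φ-trans : ∀ {x y z} → Φ 𝐋 F x y → Φ 𝐋 F y z → Φ 𝐋 F x z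
  Φ-trans {x} {y} {z} x~y (yz , zy) =
    modus-ponens yz (proj₂ (Φ-* x~y (Φ-refl z))) ,
    modus-ponens zy (proj₂ (Φ-* (Φ-refl z) x~y))

  Φ-isCongruence : IsCongruence 𝐋 (Φ 𝐋 F)
  Φ-isCongruence = record
    { isEquivalence = record { refl = Φ-refl _ ; sym = Φ-sym ; trans = Φ-trans }
    ; ∨-cong = Φ-∨
    ; ∧-cong = Φ-∧
    ; *-cong = Φ-*
    }

  class1-Φ : _≐_ 𝐋 (class1 𝐋 (Φ 𝐋 F)) F
  class1-Φ = (λ _ → Φ-𝟏⇒∈) , (λ _ → ∈⇒Φ-𝟏)

mainTheorem9 : ∀ {a} (𝐋 : LatticeSkewHilbert a) (F : Subset 𝐋) → IsFilter 𝐋 F →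
    IsCongruence 𝐋 (Φ 𝐋 F) × _≐_ 𝐋 (class1 𝐋 (Φ 𝐋 F)) F
mainTheorem9 𝐋 F isFilter = Φ-isCongruence , class1-Φ
  where open FilterCongruence 𝐋 F isFilter
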